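{- Soient $K$ et $L$ deux entiers strictement positifs. Pour tous $0 \leq k \leq K-1$ et $0 \leq \ell \leq L-1$, soit $\gamma=\left( \gamma_{p}\right)_{0 \leq p \leq L-1,\, p \neq \ell}$ un \'el\'ement de ${\mathbb Z}^{L-1}$ satisfaisant $$ \sum_{\stackrel{p=0}{p \neq \ell}}^{L-1}\gamma_{p}=K-k-1 $$ et $\gamma_{p} \geq 0$ pour tout $0 \leq p \leq L-1$, $p \neq \ell$. Alors $$ \prod_{\stackrel{p=0}{p \neq \ell}}^{L-1} { \gamma_{p} + K-1 \choose K-1} \leq \left( e \min(K,L) \right)^{K-1}. $$ -}

module Defs where

open import Data.Nat as ℕ using (ℕ; zero; suc; _^_; _!)
open import Data.Nat.Properties using (_!≢0)
open import Data.Fin using (Fin; _≟_)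
open import Data.List using (List; map; allFin; upTo)
open import Data.Nat.ListAction using (sum; product)
open import Data.Integer using (+_)
open import Data.Rational as ℚ using (ℚ; _/_; Positive; _≤_)
open import Data.Product using (∃)
open import Relation.Nullary using (yes; no)

sumExcept : ∀ {L} → Fin L → (Fin L → ℕ) → ℕ
sumExcept {L} ℓ f = sum (map (λ p → g p) (allFin L))
  where
  g : Fin L → ℕ
  g p with p ≟ ℓ
  ... | yes _ = 0
  ... | no  _ = f p

prodExcept : ∀ {L} → Fin L → (Fin L → ℕ) → ℕ
prodExcept {L} ℓ f = product (map (λ p → g p) (allFin L))
  where
  g : Fin L → ℕ
  g p with p ≟ ℓ
  ... | yes _ = 1
  ... | no  _ = f p

ℕtoℚ : ℕ → ℚ
ℕtoℚ n = (+ n) / 1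

expPartial : ℕ → ℕ → ℚ
expPartial x N = sumℚ (map term (upTo N))
  where
  term : ℕ → ℚ
  term j = _/_ (+ (x ^ j)) (j !) {{j !≢0}}
  sumℚ : List ℚ → ℚ
  sumℚ = Data.List.foldr ℚ._+_ ℚ.0ℚ

-- X ≤ (e · m)^n, i.e. X ≤ m^n · e^n with e^n = sup_N expPartial n N
-- (e defined by its exponential series). "X ≤ c · sup S" is unfolded as:
-- for every rational ε > 0 there is N with X ≤ c · (S_N + ε).
LeEMulPow : ℕ → ℕ → ℕ → Set
LeEMulPow X m n =
  (ε : ℚ) → Positive ε →
  ∃ λ N → ℕtoℚ X ≤ ℕtoℚ (m ^ n) ℚ.* (expPartial n N ℚ.+ ε)

-- With d = K − 1 and S = Σ γ_p ≤ d, the factor C(γ_p + d, d) counts the monomials of degree γ_p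
-- in d + 1 variables. If K ≤ L each factor is at most K^γ_p, so the product is at most K^S ≤ K^d.
-- Otherwise the L − 1 factors together count at most the monomials of degree S in (L − 1)d + 1
-- variables, so the product is at most C(S + (L − 1)d, S) ≤ (S + (L − 1)d)^S / S! ≤ L^d · d^S / S!,
-- and d^S / S! is a single term of the exponential series of e^d.
module Submission where

open import Defs

module ExponentialSeries where
  open import Data.Nat as ℕ using (ℕ; suc; _^_; _!)
  import Data.Nat.Properties as ℕ
  open import Data.Nat.Properties using (_!≢0; n<1+n)
  open import Data.Integer as ℤ using (+_)
  import Data.Integer.Properties as ℤ
  open import Data.Rational using (ℚ; 0ℚ; _/_; _≤_; _+_; _*_; fromℚᵘ; toℚᵘ; NonNegative)
  open import Data.Rational.Properties
  open import Data.Rational.Unnormalised as ℚᵘ using (ℚᵘ; mkℚᵘ) renaming (_≤_ to _≤ᵘ_; _*_ to _*ᵘ_)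
  import Data.Rational.Unnormalised.Properties as ℚᵘ
  open import Data.List using (List; _∷_; upTo; foldr)
  open import Data.List.Relation.Unary.All as All using (All; []; _∷_)
  import Data.List.Relation.Unary.All.Properties as All
  open import Data.List.Relation.Unary.Any using (here; there)
  open import Data.List.Membership.Propositional using (_∈_)
  open import Data.List.Membership.Propositional.Properties using (∈-map⁺; ∈-upTo⁺)
  open import Data.Product using (_,_)
  open import Relation.Binary.PropositionalEquality using (_≡_; refl; sym)

  fromℚᵘ-mono-≤ : ∀ {p q} → p ≤ᵘ q → fromℚᵘ p ≤ fromℚᵘ q
  fromℚᵘ-mono-≤ {p} {q} p≤q = toℚᵘ-cancel-≤
    (ℚᵘ.≤-respˡ-≃ (ℚᵘ.≃-sym (toℚᵘ-fromℚᵘ p)) (ℚᵘ.≤-respʳ-≃ (ℚᵘ.≃-sym (toℚᵘ-fromℚᵘ q)) p≤q))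

  fromℚᵘ-homo-* : ∀ p q → fromℚᵘ (p *ᵘ q) ≡ fromℚᵘ p * fromℚᵘ q
  fromℚᵘ-homo-* p q = toℚᵘ-injective (begin
    toℚᵘ (fromℚᵘ (p *ᵘ q))            ≈⟨ toℚᵘ-fromℚᵘ (p *ᵘ q) ⟩
    p *ᵘ q                            ≈⟨ ℚᵘ.*-cong (toℚᵘ-fromℚᵘ p) (toℚᵘ-fromℚᵘ q) ⟨
    toℚᵘ (fromℚᵘ p) *ᵘ toℚᵘ (fromℚᵘ q) ≈⟨ toℚᵘ-homo-* (fromℚᵘ p) (fromℚᵘ q) ⟨
    toℚᵘ (fromℚᵘ p * fromℚᵘ q)        ∎)
    where open ℚᵘ.≃-Reasoning

  ℕtoℚ-≤-*-/ : ∀ X A B J .{{_ : ℕ.NonZero J}} → X ℕ.* J ℕ.≤ A ℕ.* B → ℕtoℚ X ≤ ℕtoℚ A * (+ B / J)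
  -- `ℕtoℚ n` and `+ n / suc s` are, by definition, `fromℚᵘ` of the unnormalised n/1 and n/(1 + s).
  ℕtoℚ-≤-*-/ X A B (suc s) XJ≤AB = begin
    fromℚᵘ x              ≤⟨ fromℚᵘ-mono-≤ {x} {a *ᵘ b} (ℚᵘ.*≤* crossed) ⟩
    fromℚᵘ (a *ᵘ b)       ≡⟨ fromℚᵘ-homo-* a b ⟩
    fromℚᵘ a * fromℚᵘ b   ∎
    where
    open ≤-Reasoning
    x a b : ℚᵘ
    x = mkℚᵘ (+ X) 0
    a = mkℚᵘ (+ A) 0
    b = mkℚᵘ (+ B) s
    crossed : + X ℤ.* + suc (s ℕ.+ 0) ℤ.≤ (+ A ℤ.* + B) ℤ.* + 1
    crossed rewrite ℕ.+-identityʳ s | ℤ.*-identityʳ (+ A ℤ.* + B) | sym (ℤ.pos-* X (suc s)) | sym (ℤ.pos-* A B) =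
      ℤ.+≤+ XJ≤AB

  sum-nonNeg : ∀ {xs : List ℚ} → All (0ℚ ≤_) xs → 0ℚ ≤ foldr _+_ 0ℚ xs
  sum-nonNeg []         = ≤-refl
  sum-nonNeg (0≤x ∷ ps) = +-mono-≤ 0≤x (sum-nonNeg ps)

  ∈⇒≤sum : ∀ {x} {xs : List ℚ} → All (0ℚ ≤_) xs → x ∈ xs → x ≤ foldr _+_ 0ℚ xs
  ∈⇒≤sum {x} {_ ∷ ys} (_ ∷ ps) (here refl) = begin
    x                  ≡⟨ +-identityʳ x ⟨
    x + 0ℚ             ≤⟨ +-monoʳ-≤ x (sum-nonNeg ps) ⟩
    x + foldr _+_ 0ℚ ys ∎
    where open ≤-Reasoning
  ∈⇒≤sum {x} {y ∷ ys} (0≤y ∷ ps) (there x∈ys) = begin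
    x                   ≤⟨ ∈⇒≤sum ps x∈ys ⟩
    foldr _+_ 0ℚ ys      ≡⟨ +-identityˡ _ ⟨
    0ℚ + foldr _+_ 0ℚ ys ≤⟨ +-monoˡ-≤ _ 0≤y ⟩
    y + foldr _+_ 0ℚ ys  ∎
    where open ≤-Reasoning

  expTerm : ℕ → ℕ → ℚ
  expTerm x j = (+ (x ^ j) / j !) {{j !≢0}}

  expTerm≤expPartial : ∀ x j → expTerm x j ≤ expPartial x (suc j)
  expTerm≤expPartial x j = ∈⇒≤sum
    (All.map⁺ (All.universal (λ i → nonNegative⁻¹ _ {{normalize-nonNeg (x ^ i) (i !) {{i !≢0}}}}) (upTo (suc j))))
    (∈-map⁺ (expTerm x) (∈-upTo⁺ (n<1+n j)))

  LeEMulPow-intro : ∀ X m n j → X ℕ.* j ! ℕ.≤ m ^ n ℕ.* n ^ j → LeEMulPow X m n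
  LeEMulPow-intro X m n j Xj!≤ ε ε>0 = suc j , (begin
    ℕtoℚ X                                  ≤⟨ ℕtoℚ-≤-*-/ X (m ^ n) (n ^ j) (j !) {{j !≢0}} Xj!≤ ⟩
    ℕtoℚ (m ^ n) * expTerm n j              ≤⟨ *-monoˡ-≤-nonNeg (ℕtoℚ (m ^ n)) (expTerm≤expPartial n j) ⟩
    ℕtoℚ (m ^ n) * expPartial n (suc j)     ≤⟨ *-monoˡ-≤-nonNeg (ℕtoℚ (m ^ n)) (p≤p+ε (expPartial n (suc j))) ⟩
    ℕtoℚ (m ^ n) * (expPartial n (suc j) + ε) ∎)
    where
    open ≤-Reasoning
    instance
      mⁿ-nonNeg : NonNegative (ℕtoℚ (m ^ n))
      mⁿ-nonNeg = normalize-nonNeg (m ^ n) 1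
    p≤p+ε : ∀ p → p ≤ p + ε
    p≤p+ε p = begin
      p       ≡⟨ +-identityʳ p ⟨
      p + 0ℚ  ≤⟨ +-monoʳ-≤ p (nonNegative⁻¹ ε {{pos⇒nonNeg ε {{ε>0}}}}) ⟩
      p + ε   ∎

open ExponentialSeries using (LeEMulPow-intro)

open import Data.Nat using (ℕ; zero; suc; _+_; _*_; _∸_; _^_; _!; _≤_; _<_; _⊓_; z≤n; s≤s; _≤?_)
open import Data.Nat.Properties hiding (_≟_)
open import Data.Nat.Combinatorics using (_C_; nCn≡1; nCk+nC[k+1]≡[n+1]C[k+1])
open import Data.Nat.ListAction using (sum; product)
open import Data.Nat.Tactic.RingSolver using (solve-∀)
open import Data.Fin as Fin using (Fin; zero; suc; toℕ; _≟_)
open import Data.List using (map; allFin; tabulate)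
open import Data.List.Properties using (map-tabulate; tabulate-cong)
open import Data.Product using (Σ-syntax; ∃-syntax; _×_; _,_; uncurry)
open import Function using (id; _∘_)
open import Relation.Nullary using (Dec; yes; no)
open import Relation.Binary.PropositionalEquality using (_≡_; refl; sym; trans; cong; cong₂; subst; module ≡-Reasoning)

-- `multichoose c a = (a + c) C c`, the number of monomials of degree a in c + 1 variables.
multichoose : ℕ → ℕ → ℕ
multichoose zero    a       = 1
multichoose (suc c) zero    = 1
multichoose (suc c) (suc a) = multichoose c (suc a) + multichoose (suc c) a

+-C≡multichoose : ∀ c a → (a + c) C c ≡ multichoose c a
+-C≡multichoose zero    a       = refl
+-C≡multichoose (suc c) zero    = nCn≡1 (suc c)
+-C≡multichoose (suc c) (suc a) = begin
  suc (a + suc c) C suc c                   ≡⟨ nCk+nC[k+1]≡[n+1]C[k+1] (a + suc c) c ⟨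
  (a + suc c) C c + (a + suc c) C suc c     ≡⟨ cong (λ m → m C c + (a + suc c) C suc c) (+-suc a c) ⟩
  (suc a + c) C c + (a + suc c) C suc c     ≡⟨ cong₂ _+_ (+-C≡multichoose c (suc a)) (+-C≡multichoose (suc c) a) ⟩
  multichoose c (suc a) + multichoose (suc c) a ∎
  where open ≡-Reasoning

multichoose-zeroʳ : ∀ c → multichoose c 0 ≡ 1
multichoose-zeroʳ zero    = refl
multichoose-zeroʳ (suc c) = refl

multichoose-oneʳ : ∀ c → multichoose c 1 ≡ suc c
multichoose-oneʳ zero    = refl
multichoose-oneʳ (suc c) = trans (cong (_+ 1) (multichoose-oneʳ c)) (+-comm (suc c) 1)

multichoose-≤-sucʳ : ∀ c a → multichoose c a ≤ multichoose c (suc a)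
multichoose-≤-sucʳ zero    a = ≤-refl
multichoose-≤-sucʳ (suc c) a = m≤n+m (multichoose (suc c) a) (multichoose c (suc a))

multichoose-≤-sucˡ : ∀ c a → multichoose c a ≤ multichoose (suc c) a
multichoose-≤-sucˡ c zero    = ≤-reflexive (multichoose-zeroʳ c)
multichoose-≤-sucˡ c (suc a) = m≤m+n (multichoose c (suc a)) (multichoose (suc c) a)

multichoose-≤-+ʳ : ∀ c a a′ → multichoose c a′ ≤ multichoose c (a + a′)
multichoose-≤-+ʳ c zero    a′ = ≤-refl
multichoose-≤-+ʳ c (suc a) a′ = ≤-trans (multichoose-≤-+ʳ c a a′) (multichoose-≤-sucʳ c (a + a′))

multichoose-≤-+ˡ : ∀ c c′ a → multichoose c′ a ≤ multichoose (c + c′) a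
multichoose-≤-+ˡ zero    c′ a = ≤-refl
multichoose-≤-+ˡ (suc c) c′ a = ≤-trans (multichoose-≤-+ˡ c c′ a) (multichoose-≤-sucˡ (c + c′) a)

multichoose-*-≤ : ∀ c a c′ a′ → multichoose c a * multichoose c′ a′ ≤ multichoose (c + c′) (a + a′)
multichoose-*-≤ zero    a       c′ a′ = ≤-trans (≤-reflexive (+-identityʳ _)) (multichoose-≤-+ʳ c′ a a′)
multichoose-*-≤ (suc c) zero    c′ a′ = ≤-trans (≤-reflexive (+-identityʳ _)) (multichoose-≤-+ˡ (suc c) c′ a′)
multichoose-*-≤ (suc c) (suc a) c′ a′ = begin
  (multichoose c (suc a) + multichoose (suc c) a) * multichoose c′ a′
    ≡⟨ *-distribʳ-+ (multichoose c′ a′) (multichoose c (suc a)) (multichoose (suc c) a) ⟩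
  multichoose c (suc a) * multichoose c′ a′ + multichoose (suc c) a * multichoose c′ a′
    ≤⟨ +-mono-≤ (multichoose-*-≤ c (suc a) c′ a′) (multichoose-*-≤ (suc c) a c′ a′) ⟩
  multichoose (c + c′) (suc (a + a′)) + multichoose (suc (c + c′)) (a + a′) ∎
  where open ≤-Reasoning

multichoose-≤-^ : ∀ c a → multichoose c a ≤ suc c ^ a
multichoose-≤-^ zero    a       = ≤-reflexive (sym (^-zeroˡ a))
multichoose-≤-^ (suc c) zero    = ≤-refl
multichoose-≤-^ (suc c) (suc a) = begin
  multichoose c (suc a) + multichoose (suc c) a ≤⟨ +-mono-≤ (multichoose-≤-^ c (suc a)) (multichoose-≤-^ (suc c) a) ⟩
  suc c * suc c ^ a + suc (suc c) ^ a            ≤⟨ +-monoˡ-≤ _ (*-monoʳ-≤ (suc c) (^-monoˡ-≤ a (n≤1+n (suc c)))) ⟩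
  suc c * suc (suc c) ^ a + suc (suc c) ^ a      ≡⟨ +-comm (suc c * suc (suc c) ^ a) _ ⟩
  suc (suc c) ^ suc a                            ∎
  where open ≤-Reasoning

multichoose-suc-* : ∀ c a → multichoose c (suc a) * suc a ≡ multichoose c a * (suc a + c)
multichoose-suc-* zero    a       = cong (1 *_) (sym (+-identityʳ (suc a)))
multichoose-suc-* (suc c) zero    = begin
  (multichoose c 1 + 1) * 1 ≡⟨ cong (λ m → (m + 1) * 1) (multichoose-oneʳ c) ⟩
  (suc c + 1) * 1           ≡⟨ arith c ⟩
  1 * (1 + suc c)           ∎
  where
  open ≡-Reasoning
  arith : ∀ c → (suc c + 1) * 1 ≡ 1 * (1 + suc c)
  arith = solve-∀
multichoose-suc-* (suc c) (suc a) = begin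
  (x′ + y′) * suc (suc a)                         ≡⟨ *-distribʳ-+ (suc (suc a)) x′ y′ ⟩
  x′ * suc (suc a) + y′ * suc (suc a)             ≡⟨ cong₂ _+_ (multichoose-suc-* c (suc a)) (*-suc y′ (suc a)) ⟩
  x * (suc (suc a) + c) + (y′ + y′ * suc a)       ≡⟨ cong (λ m → x * (suc (suc a) + c) + (y′ + m)) (multichoose-suc-* (suc c) a) ⟩
  x * (suc (suc a) + c) + (y′ + y * (suc a + suc c)) ≡⟨ arith x y a c ⟩
  (x + y) * (suc (suc a) + suc c)                 ∎
  where
  open ≡-Reasoning
  x y x′ y′ : ℕ
  x  = multichoose c (suc a)
  y  = multichoose (suc c) a
  x′ = multichoose c (suc (suc a))
  y′ = multichoose (suc c) (suc a)
  arith : ∀ x y a c → x * (suc (suc a) + c) + ((x + y) + y * (suc a + suc c)) ≡ (x + y) * (suc (suc a) + suc c)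
  arith = solve-∀

multichoose-*-!≤^ : ∀ c a → multichoose c a * a ! ≤ (a + c) ^ a
multichoose-*-!≤^ c zero    = ≤-reflexive (cong (_* 1) (multichoose-zeroʳ c))
multichoose-*-!≤^ c (suc a) = begin
  multichoose c (suc a) * (suc a * a !) ≡⟨ *-assoc (multichoose c (suc a)) (suc a) (a !) ⟨
  multichoose c (suc a) * suc a * a !   ≡⟨ cong (_* a !) (multichoose-suc-* c a) ⟩
  multichoose c a * (suc a + c) * a !   ≡⟨ rearrange (multichoose c a) (suc a + c) (a !) ⟩
  (suc a + c) * (multichoose c a * a !) ≤⟨ *-monoʳ-≤ (suc a + c) (multichoose-*-!≤^ c a) ⟩
  (suc a + c) * (a + c) ^ a             ≤⟨ *-monoʳ-≤ (suc a + c) (^-monoˡ-≤ a (n≤1+n (a + c))) ⟩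
  (suc a + c) * (suc a + c) ^ a         ∎
  where
  open ≤-Reasoning
  rearrange : ∀ x y z → x * y * z ≡ y * (x * z)
  rearrange = solve-∀

product-≤-^-sum : ∀ {n} m (f g : Fin n → ℕ) → (∀ i → f i ≤ m ^ g i) →
  product (tabulate f) ≤ m ^ sum (tabulate g)
product-≤-^-sum {zero}  m f g f≤ = ≤-refl
product-≤-^-sum {suc n} m f g f≤ = begin
  f zero * product (tabulate (f ∘ suc))       ≤⟨ *-mono-≤ (f≤ zero) (product-≤-^-sum m (f ∘ suc) (g ∘ suc) (f≤ ∘ suc)) ⟩
  m ^ g zero * m ^ sum (tabulate (g ∘ suc))   ≡⟨ ^-distribˡ-+-* m (g zero) _ ⟨
  m ^ (g zero + sum (tabulate (g ∘ suc)))     ∎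
  where open ≤-Reasoning

product-multichoose-≤ : ∀ {n} (c a : Fin n → ℕ) →
  product (tabulate (λ i → multichoose (c i) (a i))) ≤ multichoose (sum (tabulate c)) (sum (tabulate a))
product-multichoose-≤ {zero}  c a = ≤-refl
product-multichoose-≤ {suc n} c a = ≤-trans
  (*-monoʳ-≤ (multichoose (c zero) (a zero)) (product-multichoose-≤ (c ∘ suc) (a ∘ suc)))
  (multichoose-*-≤ (c zero) (a zero) _ _)

sum-tabulate-const : ∀ n d → sum (tabulate {n = n} (λ _ → d)) ≡ n * d
sum-tabulate-const zero    d = refl
sum-tabulate-const (suc n) d = cong (_+_ d) (sum-tabulate-const n d)

except : ∀ {L} → Fin L → ℕ → (Fin L → ℕ) → Fin L → ℕ
except ℓ u f p with p ≟ ℓ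
... | yes _ = u
... | no  _ = f p

except-suc : ∀ {L} (ℓ : Fin L) u f q → except (suc ℓ) u f (suc q) ≡ except ℓ u (f ∘ suc) q
except-suc ℓ u f q with q ≟ ℓ
... | yes _ = refl
... | no  _ = refl

sum-except-const : ∀ {n} (ℓ : Fin (suc n)) d → sum (tabulate (except ℓ 0 (λ _ → d))) ≡ n * d
sum-except-const {n}     zero    d = sum-tabulate-const n d
sum-except-const {suc n} (suc ℓ) d = cong (_+_ d) (begin
  sum (tabulate (except (suc ℓ) 0 (λ _ → d) ∘ suc)) ≡⟨ cong sum (tabulate-cong (except-suc ℓ 0 (λ _ → d))) ⟩
  sum (tabulate (except ℓ 0 (λ _ → d)))             ≡⟨ sum-except-const ℓ d ⟩
  n * d                                             ∎)
  where open ≡-Reasoning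

Decider : ∀ {L} → Fin L → Set
Decider {L} ℓ = (p : Fin L) → Dec (p ≡ ℓ) → ℕ

decider≡except : ∀ {L} {ℓ : Fin L} {u f} (K : Decider ℓ) →
  (∀ p e → K p (yes e) ≡ u) → (∀ p e → K p (no e) ≡ f p) → ∀ p → K p (p ≟ ℓ) ≡ except ℓ u f p
decider≡except {ℓ = ℓ} K K-yes K-no p with p ≟ ℓ
... | yes e = K-yes p e
... | no  e = K-no p e

-- The `with`-helper behind `prodExcept` and `sumExcept` cannot be named. Abstracting the first
-- index, its decision and the list operation makes the head factor a pattern `K z d`,
-- from which unification recovers the helper.
prodExcept-decider : ∀ {n} (ℓ : Fin (suc n)) f → Σ[ K ∈ Decider ℓ ]
  (∀ p e → K p (yes e) ≡ 1) × (∀ p e → K p (no e) ≡ f p) ×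
  prodExcept ℓ f ≡ product (map (λ p → K p (p ≟ ℓ)) (allFin (suc n)))
prodExcept-decider {n} ℓ f with _*_ | Fin.zero {n} | Fin.zero ≟ ℓ
... | _ | _ | _ = _ , (λ _ _ → refl) , (λ _ _ → refl) , refl

sumExcept-decider : ∀ {n} (ℓ : Fin (suc n)) f → Σ[ K ∈ Decider ℓ ]
  (∀ p e → K p (yes e) ≡ 0) × (∀ p e → K p (no e) ≡ f p) ×
  sumExcept ℓ f ≡ sum (map (λ p → K p (p ≟ ℓ)) (allFin (suc n)))
sumExcept-decider {n} ℓ f with _+_ | Fin.zero {n} | Fin.zero ≟ ℓ
... | _ | _ | _ = _ , (λ _ _ → refl) , (λ _ _ → refl) , refl

prodExcept≡product-except : ∀ {n} (ℓ : Fin (suc n)) f → prodExcept ℓ f ≡ product (tabulate (except ℓ 1 f))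
prodExcept≡product-except {n} ℓ f with prodExcept-decider ℓ f
... | K , K-yes , K-no , eq = begin
  prodExcept ℓ f                                ≡⟨ eq ⟩
  product (map (λ p → K p (p ≟ ℓ)) (allFin _))  ≡⟨ cong product (map-tabulate id (λ p → K p (p ≟ ℓ))) ⟩
  product (tabulate (λ p → K p (p ≟ ℓ)))        ≡⟨ cong product (tabulate-cong (decider≡except K K-yes K-no)) ⟩
  product (tabulate (except ℓ 1 f))             ∎
  where open ≡-Reasoning

sumExcept≡sum-except : ∀ {n} (ℓ : Fin (suc n)) f → sumExcept ℓ f ≡ sum (tabulate (except ℓ 0 f))
sumExcept≡sum-except {n} ℓ f with sumExcept-decider ℓ f
... | K , K-yes , K-no , eq = begin
  sumExcept ℓ f                                 ≡⟨ eq ⟩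
  sum (map (λ p → K p (p ≟ ℓ)) (allFin _))      ≡⟨ cong sum (map-tabulate id (λ p → K p (p ≟ ℓ))) ⟩
  sum (tabulate (λ p → K p (p ≟ ℓ)))            ≡⟨ cong sum (tabulate-cong (decider≡except K K-yes K-no)) ⟩
  sum (tabulate (except ℓ 0 f))                 ∎
  where open ≡-Reasoning

prodExcept-C≡product-multichoose : ∀ {n} (ℓ : Fin (suc n)) (γ : Fin (suc n) → ℕ) d →
  prodExcept ℓ (λ p → (γ p + d) C d)
    ≡ product (tabulate (λ p → multichoose (except ℓ 0 (λ _ → d) p) (except ℓ 0 γ p)))
prodExcept-C≡product-multichoose ℓ γ d =
  trans (prodExcept≡product-except ℓ _) (cong product (tabulate-cong pointwise))
  where
  pointwise : ∀ p → except ℓ 1 (λ p → (γ p + d) C d) p ≡ multichoose (except ℓ 0 (λ _ → d) p) (except ℓ 0 γ p)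
  pointwise p with p ≟ ℓ
  ... | yes _ = refl
  ... | no  _ = +-C≡multichoose d (γ p)

prodExcept-C≤^ : ∀ {n} (ℓ : Fin (suc n)) (γ : Fin (suc n) → ℕ) d → sumExcept ℓ γ ≤ d →
  prodExcept ℓ (λ p → (γ p + d) C d) ≤ suc d ^ d
prodExcept-C≤^ {n} ℓ γ d Σγ≤d = begin
  prodExcept ℓ (λ p → (γ p + d) C d)                     ≡⟨ prodExcept-C≡product-multichoose ℓ γ d ⟩
  product (tabulate (λ p → multichoose (c p) (b p)))     ≤⟨ product-≤-^-sum (suc d) _ b multichoose≤ ⟩
  suc d ^ sum (tabulate b)                               ≤⟨ ^-monoʳ-≤ (suc d) (≤-trans (≤-reflexive (sym (sumExcept≡sum-except ℓ γ))) Σγ≤d) ⟩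
  suc d ^ d                                              ∎
  where
  open ≤-Reasoning
  b c : Fin (suc n) → ℕ
  b = except ℓ 0 γ
  c = except ℓ 0 (λ _ → d)
  c≤d : ∀ p → c p ≤ d
  c≤d p with p ≟ ℓ
  ... | yes _ = z≤n
  ... | no  _ = ≤-refl
  multichoose≤ : ∀ p → multichoose (c p) (b p) ≤ suc d ^ b p
  multichoose≤ p = ≤-trans (multichoose-≤-^ (c p) (b p)) (^-monoˡ-≤ (b p) (s≤s (c≤d p)))

^-distribʳ-* : ∀ x y k → (x * y) ^ k ≡ x ^ k * y ^ k
^-distribʳ-* x y zero    = refl
^-distribʳ-* x y (suc k) = begin
  x * y * (x * y) ^ k      ≡⟨ cong (x * y *_) (^-distribʳ-* x y k) ⟩
  x * y * (x ^ k * y ^ k)  ≡⟨ *-*-interchange x y (x ^ k) (y ^ k) ⟩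
  x * x ^ k * (y * y ^ k)  ∎
  where
  open ≡-Reasoning
  *-*-interchange : ∀ a b c e → a * b * (c * e) ≡ a * c * (b * e)
  *-*-interchange = solve-∀

prodExcept-C*!≤ : ∀ {n} (ℓ : Fin (suc n)) (γ : Fin (suc n) → ℕ) d → sumExcept ℓ γ ≤ d →
  prodExcept ℓ (λ p → (γ p + d) C d) * sumExcept ℓ γ ! ≤ suc n ^ d * d ^ sumExcept ℓ γ
prodExcept-C*!≤ {n} ℓ γ d S≤d = begin
  prodExcept ℓ (λ p → (γ p + d) C d) * S !
    ≡⟨ cong (_* S !) (prodExcept-C≡product-multichoose ℓ γ d) ⟩
  product (tabulate (λ p → multichoose (c p) (b p))) * S !
    ≤⟨ *-monoˡ-≤ (S !) (product-multichoose-≤ c b) ⟩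
  multichoose (sum (tabulate c)) (sum (tabulate b)) * S !
    ≡⟨ cong₂ (λ c′ b′ → multichoose c′ b′ * S !) (sum-except-const ℓ d) (sym (sumExcept≡sum-except ℓ γ)) ⟩
  multichoose (n * d) S * S !   ≤⟨ multichoose-*-!≤^ (n * d) S ⟩
  (S + n * d) ^ S               ≤⟨ ^-monoˡ-≤ S (+-monoˡ-≤ (n * d) S≤d) ⟩
  (suc n * d) ^ S               ≡⟨ ^-distribʳ-* (suc n) d S ⟩
  suc n ^ S * d ^ S             ≤⟨ *-monoˡ-≤ (d ^ S) (^-monoʳ-≤ (suc n) S≤d) ⟩
  suc n ^ d * d ^ S             ∎
  where
  open ≤-Reasoning
  S : ℕ
  S = sumExcept ℓ γ
  b c : Fin (suc n) → ℕ
  b = except ℓ 0 γ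
  c = except ℓ 0 (λ _ → d)

prodExcept-C-bound : ∀ {n} (ℓ : Fin (suc n)) (γ : Fin (suc n) → ℕ) d → sumExcept ℓ γ ≤ d →
  ∃[ j ] prodExcept ℓ (λ p → (γ p + d) C d) * j ! ≤ (suc d ⊓ suc n) ^ d * d ^ j
prodExcept-C-bound {n} ℓ γ d S≤d with suc d ≤? suc n
... | yes K≤L = 0 , (begin
  X * 1             ≡⟨ *-identityʳ X ⟩
  X                 ≤⟨ prodExcept-C≤^ ℓ γ d S≤d ⟩
  suc d ^ d         ≡⟨ cong (_^ d) (m≤n⇒m⊓n≡m K≤L) ⟨
  (suc d ⊓ suc n) ^ d ≡⟨ *-identityʳ _ ⟨
  (suc d ⊓ suc n) ^ d * 1 ∎)
  where
  open ≤-Reasoning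
  X : ℕ
  X = prodExcept ℓ (λ p → (γ p + d) C d)
... | no K≰L = S , subst (λ m → X * S ! ≤ m ^ d * d ^ S) (sym (m≥n⇒m⊓n≡n (<⇒≤ (≰⇒> K≰L))))
  (prodExcept-C*!≤ ℓ γ d S≤d)
  where
  X S : ℕ
  X = prodExcept ℓ (λ p → (γ p + d) C d)
  S = sumExcept ℓ γ

mainTheorem9 : (K L : ℕ) → 0 < K → 0 < L →
    (k : Fin K) (ℓ : Fin L) (γ : Fin L → ℕ) →
    sumExcept ℓ γ ≡ K ∸ suc (toℕ k) →
    LeEMulPow (prodExcept ℓ (λ p → (γ p + (K ∸ 1)) C (K ∸ 1))) (K ⊓ L) (K ∸ 1)
mainTheorem9 (suc d) (suc n) _ _ k ℓ γ Σγ≡d∸k =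
  uncurry (LeEMulPow-intro (prodExcept ℓ (λ p → (γ p + d) C d)) (suc d ⊓ suc n) d) (prodExcept-C-bound ℓ γ d Σγ≤d)
  where
  Σγ≤d : sumExcept ℓ γ ≤ d
  Σγ≤d = ≤-trans (≤-reflexive Σγ≡d∸k) (m∸n≤m d (toℕ k))
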